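{- For any positive integers $n_1,\dots,n_d,m$ with $n_i\le m$ for each $i\in[d]$, there exist matrices $Y_1\in\mathbb{C}^{m\times n_1},\dots,Y_d\in\mathbb{C}^{m\times n_d}$ with $\operatorname{rank}Y_i=n_i$ such that: (1) each row of each $Y_i$ contains exactly one entry equal to $1$ and all its other entries are $0$; and (2) the concatenation $(Y_1\ \cdots\ Y_d)$ has rank $\min\{m,\,n_1+\cdots+n_d-(d-1)\}$. -}

module Defs where

open import Data.Nat using (ℕ; zero; suc)
open import Data.Fin using (Fin; zero; suc)
open import Data.Rational using (ℚ; 0ℚ; _+_; _*_)
open import Data.Product using (Σ; ∃; _×_; _,_)
open import Relation.Binary.PropositionalEquality using (_≡_)
open import Relation.Nullary using (¬_)

Σℚ : (r : ℕ) → (Fin r → ℚ) → ℚ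
Σℚ zero    f = 0ℚ
Σℚ (suc r) f = f zero + Σℚ r (λ j → f (suc j))

-- An m × C matrix over ℚ, with column index set C (an arbitrary type,
-- so that block concatenations can be indexed by Σ-types).
Mat : ℕ → Set → Set
Mat m C = Fin m → C → ℚ

LinIndepCols : {m : ℕ} {C : Set} → Mat m C → (r : ℕ) → (Fin r → C) → Set
LinIndepCols {m} A r sel =
  (λc : Fin r → ℚ) →
  (∀ (row : Fin m) → Σℚ r (λ j → λc j * A row (sel j)) ≡ 0ℚ) →
  ∀ (j : Fin r) → λc j ≡ 0ℚ

HasRank : {m : ℕ} {C : Set} → Mat m C → ℕ → Set
HasRank {m} {C} A r =
  (Σ (Fin r → C) λ sel → LinIndepCols A r sel) ×
  (∀ (sel : Fin (suc r) → C) → ¬ LinIndepCols A (suc r) sel)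

concat : {m d : ℕ} {n : Fin d → ℕ} → ((i : Fin d) → Mat m (Fin (n i))) → Mat m (Σ (Fin d) (λ i → Fin (n i)))
concat Y row (i , j) = Y i row j

{-# OPTIONS --safe #-}
module Submission where

-- Each Yᵢ is the one-hot matrix of a map from the rows onto the nᵢ columns. Counting rows from 0, block i
-- owns a window of nᵢ consecutive rows starting at sᵢ = min((n₁ − 1) + ⋯ + (nᵢ₋₁ − 1), m − nᵢ): row sᵢ + j goes
-- to column j and every other row to column 0, so Yᵢ has rank nᵢ. Unclipped, consecutive windows overlap in
-- exactly one row, and clipping only moves a window left; hence each row t with 0 < t < R = min(m, 1 + Σ (nᵢ − 1))
-- lies strictly inside some window i, and the column of Yᵢ it hits is hit by no other row. Together with column 0
-- of Y₁ for row 0 this gives R columns whose restriction to rows 0, …, R − 1 is the identity except in that first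
-- column, so they are independent. Every row from R on is beyond all windows and thus equal to row 0, so the
-- concatenation has only R distinct rows, and any R + 1 of its columns are dependent by Gaussian elimination.

open import Defs

open import Algebra.Bundles using (Ring)
open import Data.Bool using (if_then_else_)
open import Data.Fin as Fin using (Fin; zero; suc; toℕ; fromℕ<; inject≤; punchIn)
open import Data.Fin.Properties
  using (toℕ<n; toℕ-fromℕ<; toℕ-inject≤; toℕ-injective; inject≤-injective; punchInᵢ≢i; all?; ¬∀⟶∃¬)
open import Data.List using (tabulate)
open import Data.Nat as ℕ using (ℕ; zero; suc; _≤_; _<_; s≤s; z<s)
import Data.Nat.Properties as ℕ
open import Data.Nat.ListAction using (sum)
open import Data.Nat.Tactic.RingSolver using (solve-∀)
open import Data.Product using (Σ; ∃; ∃₂; _×_; _,_; proj₁; proj₂)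
open import Data.Rational using (ℚ; 0ℚ; 1ℚ)
open import Data.Vec.Functional using (Vector; insertAt; removeAt)
open import Data.Vec.Functional.Properties using (insertAt-lookup; insertAt-punchIn)
open import Function using (_∘_; id; flip)
open import Relation.Binary.PropositionalEquality
open import Relation.Nullary using (¬_; Dec; yes; no; does; contradiction)
open import Relation.Nullary.Decidable using (dec-true; dec-false)

private
  variable
    k m n r : ℕ
    C : Set

oneHot : (Fin m → Fin k) → Mat m (Fin k)
oneHot f row j = if does (j Fin.≟ f row) then 1ℚ else 0ℚ

oneHot-≡ : (f : Fin m → Fin k) {row : Fin m} {j : Fin k} → j ≡ f row → oneHot f row j ≡ 1ℚ
oneHot-≡ f {row} {j} j≡f = cong (if_then 1ℚ else 0ℚ) (dec-true (j Fin.≟ f row) j≡f)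

oneHot-≢ : (f : Fin m → Fin k) {row : Fin m} {j : Fin k} → j ≢ f row → oneHot f row j ≡ 0ℚ
oneHot-≢ f {row} {j} j≢f = cong (if_then 1ℚ else 0ℚ) (dec-false (j Fin.≟ f row) j≢f)

oneHot-cong : (f : Fin m → Fin k) {row row′ : Fin m} → f row ≡ f row′ → oneHot f row ≗ oneHot f row′
oneHot-cong f f≡ j = cong (λ c → if does (j Fin.≟ c) then 1ℚ else 0ℚ) f≡

oneHot-unitRow : (f : Fin m → Fin k) (row : Fin m) →
                 Σ (Fin k) λ j → (oneHot f row j ≡ 1ℚ) × (∀ j′ → j′ ≢ j → oneHot f row j′ ≡ 0ℚ)
oneHot-unitRow f row = f row , oneHot-≡ f refl , λ _ → oneHot-≢ f

module LinearAlgebra where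

  open import Data.Rational using (_+_; _*_; -_; 1/_; ≢-nonZero)
  import Data.Rational.Properties as ℚ
  open import Data.Rational.Solver using (module +-*-Solver)
  open import Algebra.Properties.Semiring.Sum (Ring.semiring ℚ.+-*-ring)
    using (sum-cong-≗; sum-remove; sum-replicate-zero; ∑-distrib-+; *-distribˡ-sum)
    renaming (sum to ∑)
  open +-*-Solver
  open ≡-Reasoning

  Σℚ≡∑ : ∀ r (f : Vector ℚ r) → Σℚ r f ≡ ∑ f
  Σℚ≡∑ zero    f = refl
  Σℚ≡∑ (suc r) f = cong (f zero +_) (Σℚ≡∑ r (f ∘ suc))

  ∑-zero : {f : Vector ℚ n} → (∀ j → f j ≡ 0ℚ) → ∑ f ≡ 0ℚ
  ∑-zero {n} f≗0 = trans (sum-cong-≗ f≗0) (sum-replicate-zero n)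

  ∑-single : {f : Vector ℚ n} (i : Fin n) → (∀ j → j ≢ i → f j ≡ 0ℚ) → ∑ f ≡ f i
  ∑-single {suc n} {f} i others≡0 = begin
    ∑ f                     ≡⟨ sum-remove f ⟩
    f i + ∑ (removeAt f i)  ≡⟨ cong (f i +_) (∑-zero (λ j → others≡0 _ (punchInᵢ≢i i j))) ⟩
    f i + 0ℚ                ≡⟨ ℚ.+-identityʳ (f i) ⟩
    f i                     ∎

  infix 7 _·_
  _·_ : Vector ℚ n → Vector ℚ n → ℚ
  x · y = ∑ (λ j → x j * y j)

  *-nonZero : ∀ {p q} → p ≢ 0ℚ → q ≢ 0ℚ → p * q ≢ 0ℚ
  *-nonZero {p} {q} p≢0 q≢0 pq≡0 = q≢0 (begin
    q              ≡⟨ ℚ.*-identityˡ q ⟨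
    1ℚ * q         ≡⟨ cong (_* q) (ℚ.*-inverseˡ p {{≢-nonZero p≢0}}) ⟨
    p⁻¹ * p * q    ≡⟨ ℚ.*-assoc p⁻¹ p q ⟩
    p⁻¹ * (p * q)  ≡⟨ cong (p⁻¹ *_) pq≡0 ⟩
    p⁻¹ * 0ℚ       ≡⟨ ℚ.*-zeroʳ p⁻¹ ⟩
    0ℚ             ∎)
    where p⁻¹ = (1/ p) {{≢-nonZero p≢0}}

  ·-scaleˡ : ∀ a (x y : Vector ℚ n) → (λ j → a * x j) · y ≡ a * (x · y)
  ·-scaleˡ {n} a x y = begin
    ∑ {n} (λ j → a * x j * y j)    ≡⟨ sum-cong-≗ (λ j → ℚ.*-assoc a (x j) (y j)) ⟩
    ∑ {n} (λ j → a * (x j * y j))  ≡⟨ *-distribˡ-sum {n} a (λ j → x j * y j) ⟨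
    a * (x · y)                    ∎

  ·-linearʳ : ∀ a b (x y z : Vector ℚ n) → x · (λ j → a * y j + b * z j) ≡ a * (x · y) + b * (x · z)
  ·-linearʳ {n} a b x y z = begin
    x · (λ j → a * y j + b * z j)
      ≡⟨ sum-cong-≗ (λ j → solve 5 (λ a b x y z → x :* (a :* y :+ b :* z) := a :* (x :* y) :+ b :* (x :* z))
                                    refl a b (x j) (y j) (z j)) ⟩
    ∑ {n} (λ j → a * (x j * y j) + b * (x j * z j))
      ≡⟨ ∑-distrib-+ {n} (λ j → a * (x j * y j)) (λ j → b * (x j * z j)) ⟩
    ∑ {n} (λ j → a * (x j * y j)) + ∑ {n} (λ j → b * (x j * z j))
      ≡⟨ cong₂ _+_ (*-distribˡ-sum {n} a (λ j → x j * y j)) (*-distribˡ-sum {n} b (λ j → x j * z j)) ⟨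
    a * (x · y) + b * (x · z)
      ∎

  insertAt-· : ∀ (x : Vector ℚ n) p v (y : Vector ℚ (suc n)) → insertAt x p v · y ≡ v * y p + x · removeAt y p
  insertAt-· {n} x p v y = begin
    insertAt x p v · y
      ≡⟨ sum-remove {n} (λ j → insertAt x p v j * y j) ⟩
    insertAt x p v p * y p + ∑ {n} (λ q → insertAt x p v (punchIn p q) * y (punchIn p q))
      ≡⟨ cong₂ (λ u s → u * y p + s) (insertAt-lookup x p v)
               (sum-cong-≗ (λ q → cong (_* y (punchIn p q)) (insertAt-punchIn x p v q))) ⟩
    v * y p + x · removeAt y p
      ∎

  NontrivialSolution : (Fin k → Vector ℚ n) → Set
  NontrivialSolution M = ∃ λ x → (∃ λ j → x j ≢ 0ℚ) × (∀ r → x · M r ≡ 0ℚ)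

  -- Column p is cleared by row operations against row 0, scaling by the pivot instead of dividing by it.
  eliminate : (M : Fin (suc k) → Vector ℚ (suc n)) (p : Fin (suc n)) → Fin k → Vector ℚ n
  eliminate M p r = removeAt (λ j → M zero p * M (suc r) j + (- M (suc r) p) * M zero j) p

  eliminate-sound : (M : Fin (suc k) → Vector ℚ (suc n)) (p : Fin (suc n)) → M zero p ≢ 0ℚ →
                    NontrivialSolution (eliminate M p) → NontrivialSolution M
  eliminate-sound M p a≢0 (μ , (j , μj≢0) , solves) = x , (punchIn p j , x≢0) , λ where
      zero → begin
        x · M zero        ≡⟨ insertAt-· aμ p (- B) (M zero) ⟩
        - B * a + aμ · b  ≡⟨ cong (- B * a +_) (·-scaleˡ a μ b) ⟩
        - B * a + a * B   ≡⟨ solve 2 (λ a B → :- B :* a :+ a :* B := con 0ℚ) refl a B ⟩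
        0ℚ                ∎
      (suc r) → let c = M (suc r) p; S = μ · removeAt (M (suc r)) p in begin
        x · M (suc r)                              ≡⟨ insertAt-· aμ p (- B) (M (suc r)) ⟩
        - B * c + aμ · removeAt (M (suc r)) p      ≡⟨ cong (- B * c +_) (·-scaleˡ a μ _) ⟩
        - B * c + a * S                            ≡⟨ solve 4 (λ a S B c → :- B :* c :+ a :* S := a :* S :+ :- c :* B)
                                                              refl a S B c ⟩
        a * S + - c * B                            ≡⟨ ·-linearʳ a (- c) μ _ _ ⟨
        μ · eliminate M p r                        ≡⟨ solves r ⟩
        0ℚ                                         ∎
    where
    a = M zero p
    b = removeAt (M zero) p
    B = μ · b
    aμ = λ q → a * μ q
    x = insertAt aμ p (- B)
    x≢0 : x (punchIn p j) ≢ 0ℚ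
    x≢0 = subst (_≢ 0ℚ) (sym (insertAt-punchIn aμ p (- B) j)) (*-nonZero a≢0 μj≢0)

  nontrivialSolution : k < n → (M : Fin k → Vector ℚ n) → NontrivialSolution M
  nontrivialSolution {zero}  z<s       M = (λ _ → 1ℚ) , (zero , λ ()) , λ ()
  nontrivialSolution {suc k} (s≤s k<n) M with all? (λ p → M zero p ℚ.≟ 0ℚ)
  ... | yes row₀≡0 with nontrivialSolution (ℕ.m<n⇒m<1+n k<n) (M ∘ suc)
  ...   | x , x≢0 , solves = x , x≢0 , λ where
            zero    → ∑-zero (λ j → trans (cong (x j *_) (row₀≡0 j)) (ℚ.*-zeroʳ (x j)))
            (suc r) → solves r
  nontrivialSolution {suc k} (s≤s k<n) M | no row₀≢0 with ¬∀⟶∃¬ _ _ (λ p → M zero p ℚ.≟ 0ℚ) row₀≢0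
  ... | p , a≢0 = eliminate-sound M p a≢0 (nontrivialSolution k<n (eliminate M p))

  ¬LinIndepCols-factorRows : (A : Mat m C) (g : Fin k → Fin m) (h : Fin m → Fin k) →
                             (∀ row → A row ≗ A (g (h row))) →
                             (sel : Fin (suc k) → C) → ¬ LinIndepCols A (suc k) sel
  ¬LinIndepCols-factorRows {k = k} A g h factor sel indep
    with nontrivialSolution (ℕ.n<1+n k) (λ t → A (g t) ∘ sel)
  ... | x , (j , xj≢0) , solves = xj≢0 (indep x vanishes j)
    where
    vanishes : ∀ row → Σℚ (suc k) (λ j → x j * A row (sel j)) ≡ 0ℚ
    vanishes row = begin
      Σℚ (suc k) (λ j → x j * A row (sel j))   ≡⟨ Σℚ≡∑ (suc k) (λ j → x j * A row (sel j)) ⟩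
      x · (A row ∘ sel)                        ≡⟨ sum-cong-≗ (λ j → cong (x j *_) (factor row (sel j))) ⟩
      x · (A (g (h row)) ∘ sel)                ≡⟨ solves (h row) ⟩
      0ℚ                                       ∎

  -- Row ρ z has a single nonzero term, which forces x z = 0; after that, so has every other row ρ t.
  LinIndepCols-pivots : (A : Mat m C) (sel : Fin r → C) (ρ : Fin r → Fin m) (z : Fin r) →
                        (∀ t → A (ρ t) (sel t) ≡ 1ℚ) →
                        (∀ {t t′} → t′ ≢ t → t′ ≢ z → A (ρ t) (sel t′) ≡ 0ℚ) →
                        LinIndepCols A r sel
  LinIndepCols-pivots {r = r} A sel ρ z diag off x solves = x≡0
    where
    x≡0-at : ∀ t → (∀ j → j ≢ t → x j * A (ρ t) (sel j) ≡ 0ℚ) → x t ≡ 0ℚ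
    x≡0-at t others = begin
      x t                                      ≡⟨ trans (cong (x t *_) (diag t)) (ℚ.*-identityʳ (x t)) ⟨
      x t * A (ρ t) (sel t)                    ≡⟨ ∑-single t others ⟨
      x · (A (ρ t) ∘ sel)                      ≡⟨ Σℚ≡∑ r _ ⟨
      Σℚ r (λ j → x j * A (ρ t) (sel j))       ≡⟨ solves (ρ t) ⟩
      0ℚ                                       ∎
    xz≡0 : x z ≡ 0ℚ
    xz≡0 = x≡0-at z (λ j j≢z → trans (cong (x j *_) (off j≢z j≢z)) (ℚ.*-zeroʳ (x j)))
    x≡0 : ∀ t → x t ≡ 0ℚ
    x≡0 t = x≡0-at t others
      where
      others : ∀ j → j ≢ t → x j * A (ρ t) (sel j) ≡ 0ℚ
      others j j≢t with j Fin.≟ z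
      ... | yes refl = trans (cong (_* A (ρ t) (sel j)) xz≡0) (ℚ.*-zeroˡ (A (ρ t) (sel j)))
      ... | no  j≢z  = trans (cong (x j *_) (off j≢t j≢z)) (ℚ.*-zeroʳ (x j))

  HasRank-byPivots : (A : Mat m C) (sel : Fin r → C) (ρ : Fin r → Fin m) (z : Fin r) (h : Fin m → Fin r) →
                     (∀ t → A (ρ t) (sel t) ≡ 1ℚ) →
                     (∀ {t t′} → t′ ≢ t → t′ ≢ z → A (ρ t) (sel t′) ≡ 0ℚ) →
                     (∀ row → A row ≗ A (ρ (h row))) →
                     HasRank A r
  HasRank-byPivots A sel ρ z h diag off factor =
    (sel , LinIndepCols-pivots A sel ρ z diag off) , ¬LinIndepCols-factorRows A ρ h factor

open LinearAlgebra using (HasRank-byPivots)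

open import Data.Nat using (_+_; _∸_; _⊓_; pred)

prefix : ∀ {d} → (Fin d → ℕ) → Fin d → ℕ
prefix a zero    = 0
prefix a (suc i) = a zero + prefix (a ∘ suc) i

prefix+≤sum : ∀ {d} (a : Fin d → ℕ) i → prefix a i + a i ≤ sum (tabulate a)
prefix+≤sum a zero    = ℕ.m≤m+n (a zero) _
prefix+≤sum a (suc i) = subst (_≤ sum (tabulate a)) (sym (ℕ.+-assoc (a zero) _ _))
  (ℕ.+-monoʳ-≤ (a zero) (prefix+≤sum (a ∘ suc) i))

prefix-cover : ∀ {d} (a : Fin d → ℕ) {t} → t < sum (tabulate a) →
               ∃₂ λ i j → j < a i × t ≡ prefix a i + j
prefix-cover {suc d} a {t} t<sum with t ℕ.<? a zero
... | yes t<a₀ = zero , t , t<a₀ , refl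
... | no  t≮a₀ with prefix-cover (a ∘ suc) {t ∸ a zero}
                       (subst (t ∸ a zero <_) (ℕ.m+n∸m≡n (a zero) _) (ℕ.∸-monoˡ-< t<sum (ℕ.≮⇒≥ t≮a₀)))
...   | i , j , j<aᵢ , t∸a₀≡ = suc i , j , j<aᵢ , (begin
  t                                   ≡⟨ sym (ℕ.m+[n∸m]≡n (ℕ.≮⇒≥ t≮a₀)) ⟩
  a zero + (t ∸ a zero)               ≡⟨ cong (a zero +_) t∸a₀≡ ⟩
  a zero + (prefix (a ∘ suc) i + j)   ≡⟨ sym (ℕ.+-assoc (a zero) _ j) ⟩
  prefix a (suc i) + j                ∎)
  where open ≡-Reasoning

sum-tabulate-pred : ∀ {d} (a : Fin d → ℕ) → (∀ i → 0 < a i) →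
                    sum (tabulate a) ≡ sum (tabulate (pred ∘ a)) + d
sum-tabulate-pred {zero}  a a>0 = refl
sum-tabulate-pred {suc d} a a>0 = begin
  a zero + sum (tabulate (a ∘ suc))
    ≡⟨ cong₂ _+_ (sym (ℕ.suc-pred (a zero) {{ℕ.>-nonZero (a>0 zero)}})) (sum-tabulate-pred (a ∘ suc) (a>0 ∘ suc)) ⟩
  suc (pred (a zero)) + (sum (tabulate (pred ∘ a ∘ suc)) + d)
    ≡⟨ shuffle (pred (a zero)) _ d ⟩
  pred (a zero) + sum (tabulate (pred ∘ a ∘ suc)) + suc d
    ∎
  where
  open ≡-Reasoning
  shuffle : ∀ x y d → suc x + (y + d) ≡ x + y + suc d
  shuffle = solve-∀

-- Rows r before the window also land at position 0, since then r ∸ σ = 0.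
offsetIn : ℕ → {k : ℕ} → 0 < k → ℕ → Fin k
offsetIn σ {k} k>0 r with r ∸ σ ℕ.<? k
... | yes r∸σ<k = fromℕ< r∸σ<k
... | no  _     = fromℕ< k>0

module _ (σ : ℕ) {k : ℕ} (k>0 : 0 < k) where

  toℕ-offsetIn-< : ∀ {r} → r ∸ σ < k → toℕ (offsetIn σ k>0 r) ≡ r ∸ σ
  toℕ-offsetIn-< {r} r∸σ<k with r ∸ σ ℕ.<? k
  ... | yes _     = toℕ-fromℕ< _
  ... | no  r∸σ≮k = contradiction r∸σ<k r∸σ≮k

  toℕ-offsetIn-≮ : ∀ {r} → ¬ (r ∸ σ < k) → toℕ (offsetIn σ k>0 r) ≡ 0
  toℕ-offsetIn-≮ {r} r∸σ≮k with r ∸ σ ℕ.<? k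
  ... | yes r∸σ<k = contradiction r∸σ<k r∸σ≮k
  ... | no  _     = toℕ-fromℕ< k>0

  toℕ-offsetIn-zero : toℕ (offsetIn σ k>0 0) ≡ 0
  toℕ-offsetIn-zero = trans (toℕ-offsetIn-< (subst (_< k) (sym (ℕ.0∸n≡0 σ)) k>0)) (ℕ.0∸n≡0 σ)

  toℕ-offsetIn-≥ : ∀ {r} → σ + k ≤ r → toℕ (offsetIn σ k>0 r) ≡ 0
  toℕ-offsetIn-≥ σ+k≤r = toℕ-offsetIn-≮
    (ℕ.≤⇒≯ (subst (_≤ _ ∸ σ) (ℕ.m+n∸m≡n σ k) (ℕ.∸-monoˡ-≤ σ σ+k≤r)))

  offsetIn-injective : ∀ {r r′} → σ < r → r < σ + k → offsetIn σ k>0 r′ ≡ offsetIn σ k>0 r → r′ ≡ r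
  offsetIn-injective {r} {r′} σ<r r<σ+k eq = by-cases (r′ ∸ σ ℕ.<? k)
    where
    0<r∸σ : 0 < r ∸ σ
    0<r∸σ = ℕ.m<n⇒0<n∸m σ<r
    toℕ-offset≡r∸σ : toℕ (offsetIn σ k>0 r′) ≡ r ∸ σ
    toℕ-offset≡r∸σ = trans (cong toℕ eq)
      (toℕ-offsetIn-< (subst (r ∸ σ <_) (ℕ.m+n∸m≡n σ k) (ℕ.∸-monoˡ-< r<σ+k (ℕ.<⇒≤ σ<r))))
    by-cases : Dec (r′ ∸ σ < k) → r′ ≡ r
    by-cases (yes r′∸σ<k) = ℕ.∸-cancelʳ-≡ σ≤r′ (ℕ.<⇒≤ σ<r) r′∸σ≡r∸σ
      where
      r′∸σ≡r∸σ : r′ ∸ σ ≡ r ∸ σ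
      r′∸σ≡r∸σ = trans (sym (toℕ-offsetIn-< r′∸σ<k)) toℕ-offset≡r∸σ
      σ≤r′ : σ ≤ r′
      σ≤r′ = ℕ.<⇒≤ (ℕ.m∸n≢0⇒n<m λ r′∸σ≡0 → ℕ.<⇒≢ 0<r∸σ (trans (sym r′∸σ≡0) r′∸σ≡r∸σ))
    by-cases (no r′∸σ≮k) = contradiction (trans (sym (toℕ-offsetIn-≮ r′∸σ≮k)) toℕ-offset≡r∸σ) (ℕ.<⇒≢ 0<r∸σ)

<-⊓-+ : ∀ {t p q k} → t < p + k → t < q + k → t < p ⊓ q + k
<-⊓-+ {p = p} {q} {k} t<p+k t<q+k = subst (_ <_) (sym (ℕ.+-distribʳ-⊓ k p q)) (ℕ.⊓-glb t<p+k t<q+k)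

module Staircase {d m : ℕ} (n : Fin (suc d) → ℕ) (n>0 : ∀ i → 0 < n i) (n≤m : ∀ i → n i ≤ suc m) where

  T : ℕ
  T = sum (tabulate (pred ∘ n))

  windowStart : Fin (suc d) → ℕ
  windowStart i = prefix (pred ∘ n) i ⊓ (suc m ∸ n i)

  position : (i : Fin (suc d)) → Fin (suc m) → Fin (n i)
  position i r = offsetIn (windowStart i) (n>0 i) (toℕ r)

  Y : (i : Fin (suc d)) → Mat (suc m) (Fin (n i))
  Y i = oneHot (position i)

  suc-pred-n : ∀ i → suc (pred (n i)) ≡ n i
  suc-pred-n i = ℕ.suc-pred (n i) {{ℕ.>-nonZero (n>0 i)}}

  window-fits : ∀ i → windowStart i + n i ≤ suc m
  window-fits i = subst (windowStart i + n i ≤_) (ℕ.m∸n+n≡m (n≤m i)) (ℕ.+-monoˡ-≤ (n i) (ℕ.m⊓n≤n _ _))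

  window-end : ∀ i → windowStart i + n i ≤ suc T
  window-end i = begin
    windowStart i + n i                     ≤⟨ ℕ.+-monoˡ-≤ (n i) (ℕ.m⊓n≤m _ _) ⟩
    prefix (pred ∘ n) i + n i               ≡⟨ cong (prefix (pred ∘ n) i +_) (sym (suc-pred-n i)) ⟩
    prefix (pred ∘ n) i + suc (pred (n i))  ≡⟨ ℕ.+-suc _ _ ⟩
    suc (prefix (pred ∘ n) i + pred (n i))  ≤⟨ s≤s (prefix+≤sum (pred ∘ n) i) ⟩
    suc T                                   ∎
    where open ℕ.≤-Reasoning

  windowRow : (i : Fin (suc d)) → Fin (n i) → Fin (suc m)
  windowRow i j = fromℕ< (ℕ.<-≤-trans (ℕ.+-monoʳ-< (windowStart i) (toℕ<n j)) (window-fits i))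

  position-windowRow : ∀ i j → position i (windowRow i j) ≡ j
  position-windowRow i j = toℕ-injective (trans
    (toℕ-offsetIn-< (windowStart i) (n>0 i) (subst (_< n i) (sym offset≡j) (toℕ<n j)))
    offset≡j)
    where
    offset≡j : toℕ (windowRow i j) ∸ windowStart i ≡ toℕ j
    offset≡j = trans (cong (_∸ windowStart i) (toℕ-fromℕ< _)) (ℕ.m+n∸m≡n (windowStart i) (toℕ j))

  rank-Y : ∀ i → HasRank (Y i) (n i)
  rank-Y i = HasRank-byPivots (Y i) id (windowRow i) (fromℕ< (n>0 i)) (position i)
    (λ t → oneHot-≡ (position i) (sym (position-windowRow i t)))
    (λ {t} t′≢t _ → oneHot-≢ (position i) (t′≢t ∘ flip trans (position-windowRow i t)))
    (λ row → oneHot-cong (position i) (sym (position-windowRow i (position i row))))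

  -- Definitionally equal to suc m ⊓ suc T.
  R : ℕ
  R = suc (m ⊓ T)

  R≤suc-m : R ≤ suc m
  R≤suc-m = s≤s (ℕ.m⊓n≤m m T)

  pivotRow : Fin R → Fin (suc m)
  pivotRow t = inject≤ t R≤suc-m

  pivotRow-injective : ∀ {t t′} → toℕ (pivotRow t) ≡ toℕ (pivotRow t′) → t ≡ t′
  pivotRow-injective {t} {t′} = inject≤-injective R≤suc-m R≤suc-m t t′ ∘ toℕ-injective

  toℕ-pivotRow : ∀ t → toℕ (pivotRow t) ≡ toℕ t
  toℕ-pivotRow t = toℕ-inject≤ t _

  cover : (u : Fin (m ⊓ T)) → ∃₂ λ i j → j < pred (n i) × toℕ u ≡ prefix (pred ∘ n) i + j
  cover u = prefix-cover (pred ∘ n) (ℕ.<-≤-trans (toℕ<n u) (ℕ.m⊓n≤n m T))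

  pivotBlock : Fin R → Fin (suc d)
  pivotBlock zero    = zero
  pivotBlock (suc u) = proj₁ (cover u)

  pivotBlock-window : ∀ u → let i = pivotBlock (suc u); r = toℕ (pivotRow (suc u)) in
                      windowStart i < r × r < windowStart i + n i
  pivotBlock-window u rewrite toℕ-pivotRow (suc u) with cover u
  ... | i , j , j<n∸1 , u≡p+j = s≤s start≤u , <-⊓-+ {p = p} u<p+n u<m
    where
    p = prefix (pred ∘ n) i
    start≤u : windowStart i ≤ toℕ u
    start≤u = ℕ.≤-trans (ℕ.m⊓n≤m p _) (subst (p ≤_) (sym u≡p+j) (ℕ.m≤m+n p j))
    u<p+n : suc (toℕ u) < p + n i
    u<p+n = subst (suc (toℕ u) <_) (trans (sym (ℕ.+-suc p _)) (cong (p +_) (suc-pred-n i)))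
              (s≤s (subst (_< p + pred (n i)) (sym u≡p+j) (ℕ.+-monoʳ-< p j<n∸1)))
    u<m : suc (toℕ u) < suc m ∸ n i + n i
    u<m = subst (suc (toℕ u) <_) (sym (ℕ.m∸n+n≡m (n≤m i))) (s≤s (ℕ.<-≤-trans (toℕ<n u) (ℕ.m⊓n≤m m T)))

  pivotColumn : Fin R → Σ (Fin (suc d)) (Fin ∘ n)
  pivotColumn t = pivotBlock t , position (pivotBlock t) (pivotRow t)

  collapse : Fin (suc m) → Fin R
  collapse r with toℕ r ℕ.<? R
  ... | yes r<R = fromℕ< r<R
  ... | no  _   = zero

  position-beyond : ∀ i {r} → T < toℕ r → position i r ≡ position i zero
  position-beyond i T<r = toℕ-injective (trans
    (toℕ-offsetIn-≥ (windowStart i) (n>0 i) (ℕ.≤-trans (window-end i) T<r))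
    (sym (toℕ-offsetIn-zero (windowStart i) (n>0 i))))

  rows-collapse : ∀ r → concat Y r ≗ concat Y (pivotRow (collapse r))
  rows-collapse r with toℕ r ℕ.<? R
  ... | yes r<R = λ c → cong (λ row → concat Y row c) (sym pivotRow-collapse)
    where
    pivotRow-collapse : pivotRow (fromℕ< r<R) ≡ r
    pivotRow-collapse = toℕ-injective (trans (toℕ-pivotRow _) (toℕ-fromℕ< r<R))
  ... | no  r≮R = λ (i , j) → oneHot-cong (position i) (position-beyond i T<r) j
    where
    T<r : T < toℕ r
    T<r = ℕ.≰⇒> λ r≤T → r≮R (s≤s (ℕ.⊓-glb (ℕ.s≤s⁻¹ (toℕ<n r)) r≤T))

  rank-concat : HasRank (concat Y) R
  rank-concat = HasRank-byPivots (concat Y) pivotColumn pivotRow zero collapse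
    (λ t → oneHot-≡ (position (pivotBlock t)) refl)
    off
    rows-collapse
    where
    off : ∀ {t t′} → t′ ≢ t → t′ ≢ zero → concat Y (pivotRow t) (pivotColumn t′) ≡ 0ℚ
    off {t′ = zero}  _    t′≢0 = contradiction refl t′≢0
    off {t} {suc u} t′≢t _ = oneHot-≢ (position i) λ same →
      t′≢t (sym (pivotRow-injective (offsetIn-injective (windowStart i) (n>0 i) lo hi (sym same))))
      where
      i = pivotBlock (suc u)
      lo = proj₁ (pivotBlock-window u)
      hi = proj₂ (pivotBlock-window u)

  rank-formula : (sum (tabulate n) + 1) ∸ suc d ≡ suc T
  rank-formula = begin
    (sum (tabulate n) + 1) ∸ suc d  ≡⟨ cong (λ s → (s + 1) ∸ suc d) (sum-tabulate-pred n n>0) ⟩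
    (T + suc d + 1) ∸ suc d         ≡⟨ cong (_∸ suc d) (shuffle T (suc d)) ⟩
    (suc T + suc d) ∸ suc d         ≡⟨ ℕ.m+n∸n≡m (suc T) (suc d) ⟩
    suc T                           ∎
    where
    open ≡-Reasoning
    shuffle : ∀ x y → x + y + 1 ≡ suc x + y
    shuffle = solve-∀

lemma5p3 : (d : ℕ) → 1 ≤ d → (m : ℕ) → 1 ≤ m → (n : Fin d → ℕ) →
           (∀ i → 1 ≤ n i) → (∀ i → n i ≤ m) →
           Σ ((i : Fin d) → Mat m (Fin (n i))) λ Y →
             (∀ i → HasRank (Y i) (n i)) ×
             (∀ i (row : Fin m) → Σ (Fin (n i)) λ j →
                (Y i row j ≡ 1ℚ) × (∀ j′ → j′ ≢ j → Y i row j′ ≡ 0ℚ)) ×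
             HasRank (concat {m} {d} {n} Y) (m ⊓ ((sum (tabulate n) + 1) ∸ d))
lemma5p3 (suc d) _ (suc m) _ n n>0 n≤m =
  Y , rank-Y , (λ i → oneHot-unitRow (position i)) ,
  subst (λ r → HasRank (concat Y) (suc m ⊓ r)) (sym rank-formula) rank-concat
  where open Staircase n n>0 n≤m
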